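{- $\mathbb{P}(\mathbb{P}(L_3))=\mathbb{P}(L_3)$; that is, for every $\Gamma\subseteq For$, the consequence set of $\Gamma$ in the paraconsistentization of $\mathbb{P}(L_3)$ equals $Cn^{\mathbb{P}}_{L_3}(\Gamma)$.
   Context: $For$ is the set of formulas built from a countable set $Prop$ of propositional letters with $\neg,\vee,\wedge,\rightarrow$. $L_3$ (Łukasiewicz) is given by the matrix with truth values $\{0,1/2,1\}$, designated set $\{1\}$, $f_\neg(x)=1-x$, $f_\vee=\max$, $f_\wedge=\min$, $f_\rightarrow(x,y)=\min\{1,1-x+y\}$; valuations are maps $Prop\to\{0,1/2,1\}$ extended via these functions. $\Gamma\vDash_{L_3}\alpha$ iff every valuation giving all members of $\Gamma$ value $1$ gives $\alpha$ value $1$; $Cn_{L_3}(\Gamma)=\{\alpha:\Gamma\vDash_{L_3}\alpha\}$. For a consequence structure $L=\langle X,Cn_L\rangle$ ($X$ a nonempty set, $Cn_L:\wp(X)\to\wp(X)$ any map), $\Gamma\subseteq X$ is $L$-consistent iff $Cn_L(\Gamma)\neq X$, and the paraconsistentization is $\mathbb{P}(L)=\langle X,Cn^{\mathbb{P}}_L\rangle$ with $Cn^{\mathbb{P}}_L(\Gamma)=\bigcup\{Cn_L(\Gamma'):\Gamma'\subseteq\Gamma,\ \Gamma'\ L\text{ -consistent}\}$. $\mathbb{P}(L_3)$ is the paraconsistentization of $\langle For,Cn_{L_3}\rangle$, and $\mathbb{P}(\mathbb{P}(L_3))$ is the paraconsistentization of $\mathbb{P}(L_3)$. -}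

module Defs where

open import Level using (Level; _⊔_) renaming (suc to lsuc; zero to 0ℓ)
open import Data.Nat using (ℕ)
open import Data.Product using (Σ; ∃; _×_; _,_)
open import Relation.Nullary using (¬_)
open import Relation.Unary using (Pred; _⊆_; _∈_)
open import Relation.Binary.PropositionalEquality using (_≡_)

data For : Set where
  var  : ℕ → For
  ¬'_  : For → For
  _∨'_ : For → For → For
  _∧'_ : For → For → For
  _⇒'_ : For → For → For

-- Łukasiewicz truth values {0, 1/2, 1}
data V3 : Set where
  v0 vh v1 : V3

f¬ : V3 → V3
f¬ v0 = v1
f¬ vh = vh
f¬ v1 = v0

f∨ : V3 → V3 → V3
f∨ v0 y = y
f∨ vh v0 = vh
f∨ vh vh = vh
f∨ vh v1 = v1
f∨ v1 _ = v1

f∧ : V3 → V3 → V3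
f∧ v0 _ = v0
f∧ vh v0 = v0
f∧ vh vh = vh
f∧ vh v1 = vh
f∧ v1 y = y

-- min{1, 1 - x + y}
f⇒ : V3 → V3 → V3
f⇒ v0 _  = v1
f⇒ vh v0 = vh
f⇒ vh vh = v1
f⇒ vh v1 = v1
f⇒ v1 y  = y

Valuation : Set
Valuation = ℕ → V3

⟦_⟧ : For → Valuation → V3
⟦ var p ⟧ v = v p
⟦ ¬' a ⟧ v = f¬ (⟦ a ⟧ v)
⟦ a ∨' b ⟧ v = f∨ (⟦ a ⟧ v) (⟦ b ⟧ v)
⟦ a ∧' b ⟧ v = f∧ (⟦ a ⟧ v) (⟦ b ⟧ v)
⟦ a ⇒' b ⟧ v = f⇒ (⟦ a ⟧ v) (⟦ b ⟧ v)

_⊨L3_ : Pred For 0ℓ → For → Set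
Γ ⊨L3 α = (v : Valuation) → (∀ γ → γ ∈ Γ → ⟦ γ ⟧ v ≡ v1) → ⟦ α ⟧ v ≡ v1

CnL3 : Pred For 0ℓ → Pred For 0ℓ
CnL3 Γ α = Γ ⊨L3 α

-- A consequence operator on X taking subsets at level a to subsets at level b
-- (levels are needed only because of predicativity; any map is allowed).
ConsOp : (X : Set) (a b : Level) → Set (lsuc (a ⊔ b))
ConsOp X a b = Pred X a → Pred X b

Consistent : {X : Set} {a b : Level} → ConsOp X a b → Pred X a → Set b
Consistent {X} Cn Γ = ¬ (∀ (x : X) → x ∈ Cn Γ)

CnP : {X : Set} {a b : Level} → ConsOp X a b → ConsOp X a (lsuc a ⊔ b)
CnP {X} {a} Cn Γ x = Σ (Pred X a) λ Γ' → (Γ' ⊆ Γ) × Consistent Cn Γ' × (x ∈ Cn Γ')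

_≐_ : {X : Set} {a b : Level} → Pred X a → Pred X b → Set (a ⊔ b)
A ≐ B = (A ⊆ B) × (B ⊆ A)

-- A consistent subset of a subset of Γ that is consistent for Cn^P is already a
-- consistent subset of Γ, so iterating the paraconsistentization never adds
-- consequences. Conversely Cn^P is never trivial as soon as some formula x is
-- explosive (entailed by no consistent set): then x ∉ Cn^P(Δ) for every Δ, so Γ
-- itself witnesses Cn^P(Γ) ⊆ Cn^P(Cn^P)(Γ). In L₃ the formula α ∧ ¬α is
-- explosive because it never takes the value 1.
module Submission where

open import Level using (Level; _⊔_) renaming (suc to lsuc; zero to 0ℓ)
open import Data.Product using (∃; _,_)
open import Relation.Unary using (Pred; _⊆_; _∉_)
open import Function using (id)
open import Relation.Binary.PropositionalEquality using (_≢_)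
open import Data.Empty using (⊥-elim)

open import Defs

module _ {X : Set} {a b : Level} (Cn : ConsOp X a b) where

  Explosive : X → Set (lsuc a ⊔ b)
  Explosive x = ∀ Δ → Consistent Cn Δ → x ∉ Cn Δ

  CnP-CnP⊆CnP : (Γ : Pred X a) → CnP (CnP Cn) Γ ⊆ CnP Cn Γ
  CnP-CnP⊆CnP Γ (Γ' , Γ'⊆Γ , _ , Γ'' , Γ''⊆Γ' , Γ''-consistent , x∈CnΓ'') =
    Γ'' , (λ y∈Γ'' → Γ'⊆Γ (Γ''⊆Γ' y∈Γ'')) , Γ''-consistent , x∈CnΓ''

  explosive⇒CnP-consistent : ∃ Explosive → (Γ : Pred X a) → Consistent (CnP Cn) Γ
  explosive⇒CnP-consistent (x , x-explosive) Γ everything∈CnPΓ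
    with everything∈CnPΓ x
  ... | Γ' , _ , Γ'-consistent , x∈CnΓ' = x-explosive Γ' Γ'-consistent x∈CnΓ'

  explosive⇒CnP-CnP≐CnP : ∃ Explosive → (Γ : Pred X a) → CnP (CnP Cn) Γ ≐ CnP Cn Γ
  explosive⇒CnP-CnP≐CnP explosive Γ =
    CnP-CnP⊆CnP Γ ,
    λ x∈CnPΓ → Γ , id , explosive⇒CnP-consistent explosive Γ , x∈CnPΓ

contradiction-undesignated : ∀ α v → ⟦ α ∧' (¬' α) ⟧ v ≢ v1
contradiction-undesignated α v with ⟦ α ⟧ v
... | v0 = λ ()
... | vh = λ ()
... | v1 = λ ()

contradiction-explosive : ∀ α → Explosive CnL3 (α ∧' (¬' α))
contradiction-explosive α Δ Δ-consistent Δ⊨α∧¬α =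
  Δ-consistent λ β v v⊨Δ → ⊥-elim (contradiction-undesignated α v (Δ⊨α∧¬α v v⊨Δ))


corollary6 : (Γ : Pred For 0ℓ) → CnP (CnP CnL3) Γ ≐ CnP CnL3 Γ
corollary6 = explosive⇒CnP-CnP≐CnP CnL3 (var 0 ∧' (¬' var 0) , contradiction-explosive (var 0))
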